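{- Let $\mathbb{K}$ be a field of characteristic $0$, let $\alpha\in\mathbb{K}^\times$ be such that the Kummer exponent $\varrho_{\mathbb{K}}(\alpha)$ is finite, and let $n$ be a positive integer. Then: (1) $\alpha\in\mu_{\mathbb{K}}\mathbb{K}^n$ if and only if $n\mid\varrho_{\mathbb{K}}(\alpha)$; (2) for any $n$-th root $\alpha^{1/n}\in\overline{\mathbb{K}}$ of $\alpha$ and any root of unity $\xi\in\overline{\mathbb{K}}$, the degree $[\mathbb{K}(\alpha^{1/n}\xi):\mathbb{K}]$ is a multiple of $n/\gcd(\varrho_{\mathbb{K}}(\alpha),n)$.
   Context: $\overline{\mathbb{K}}$ is a fixed algebraic closure, $\mu_{\mathbb{K}}$ the group of roots of unity in $\mathbb{K}$, and $\mathbb{K}^n=\{\beta^n:\beta\in\mathbb{K}\}$. The Kummer exponent of $\alpha\in\mathbb{K}^\times$ is $\varrho_{\mathbb{K}}(\alpha)=\max\{n\ge1:\alpha\in\mu_{\mathbb{K}}\mathbb{K}^n\}$ (set to $\infty$ if the set is unbounded). -}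

module Defs where

open import Level using (Level; _⊔_) renaming (suc to lsuc)
open import Data.Nat using (ℕ; zero; suc; _≤_; NonZero; ≢-nonZero; ≢-nonZero⁻¹)
open import Data.Nat.GCD using (gcd; gcd[m,n]≢0)
open import Data.Nat.DivMod using (_/_)
open import Data.Fin using (Fin; zero; suc; toℕ)
open import Data.Product using (Σ; ∃; _×_; _,_)
open import Data.Sum using (inj₂)
open import Relation.Nullary using (¬_)
open import Algebra.Bundles using (CommutativeRing)
open import Algebra.Morphism.Structures using (module RingMorphisms)

record Field (c ℓ : Level) : Set (lsuc (c ⊔ ℓ)) where
  field
    commutativeRing : CommutativeRing c ℓ
  open CommutativeRing commutativeRing public
  field
    1≉0     : ¬ (1# ≈ 0#)
    inverse : ∀ x → ¬ (x ≈ 0#) → Σ Carrier (λ y → (x * y) ≈ 1#)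

module _ {c ℓ : Level} (K : Field c ℓ) where
  open Field K using (Carrier; _≈_; _+_; _*_; 0#; 1#)

  pow : Carrier → ℕ → Carrier
  pow x zero    = 1#
  pow x (suc m) = x * pow x m

  natK : ℕ → Carrier
  natK zero    = 0#
  natK (suc m) = 1# + natK m

  CharZero : Set ℓ
  CharZero = ∀ m → ¬ (natK (suc m) ≈ 0#)

  IsRootOfUnity : Carrier → Set ℓ
  IsRootOfUnity ξ = Σ ℕ (λ m → pow ξ (suc m) ≈ 1#)

  InMuPow : Carrier → ℕ → Set (c ⊔ ℓ)
  InMuPow α n = Σ Carrier (λ ζ → IsRootOfUnity ζ × Σ Carrier (λ β → α ≈ (ζ * pow β n)))

  -- r = ϱ_K(α) = max { n ≥ 1 : α ∈ μ_K K^n }  (in particular this max exists, i.e. is finite)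
  IsKummerExponent : Carrier → ℕ → Set (c ⊔ ℓ)
  IsKummerExponent α r = (1 ≤ r) × InMuPow α r × (∀ m → 1 ≤ m → InMuPow α m → m ≤ r)

  sumFin : (d : ℕ) → (Fin d → Carrier) → Carrier
  sumFin zero    f = 0#
  sumFin (suc d) f = f zero + sumFin d (λ i → f (suc i))

  evalMonic : (d : ℕ) → (Fin d → Carrier) → Carrier → Carrier
  evalMonic d cs x = pow x d + sumFin d (λ i → cs i * pow x (toℕ i))

  IsAlgClosed : Set (c ⊔ ℓ)
  IsAlgClosed = ∀ d (cs : Fin (suc d) → Carrier) → Σ Carrier (λ x → evalMonic (suc d) cs x ≈ 0#)

record FieldHom {c ℓ c' ℓ' : Level} (K : Field c ℓ) (L : Field c' ℓ') : Set (c ⊔ ℓ ⊔ c' ⊔ ℓ') where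
  open RingMorphisms (Field.rawRing K) (Field.rawRing L)
  field
    ⟦_⟧   : Field.Carrier K → Field.Carrier L
    isRingHomomorphism : IsRingHomomorphism ⟦_⟧

module _ {c ℓ c' ℓ' : Level} {K : Field c ℓ} {L : Field c' ℓ'} (ι : FieldHom K L) where
  open FieldHom ι

  RootOfMonicOver : Field.Carrier L → ℕ → Set (c ⊔ ℓ')
  RootOfMonicOver x d = Σ (Fin d → Field.Carrier K) (λ cs →
    Field._≈_ L (evalMonic L d (λ i → ⟦ cs i ⟧) x) (Field.0# L))

  IsAlgebraicOver : Set (c ⊔ c' ⊔ ℓ')
  IsAlgebraicOver = ∀ x → Σ ℕ (λ d → RootOfMonicOver x d)

  IsAlgebraicClosure : Set (c ⊔ c' ⊔ ℓ')
  IsAlgebraicClosure = IsAlgClosed L × IsAlgebraicOver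

  -- [K(x) : K] = d, i.e. d is the degree of the minimal polynomial of x over K
  -- (least degree of a monic polynomial over K vanishing at x)
  DegreeOver : Field.Carrier L → ℕ → Set (c ⊔ ℓ')
  DegreeOver x d = RootOfMonicOver x d × (∀ e → RootOfMonicOver x e → d ≤ e)

quotGcd : (n r : ℕ) → .{{NonZero n}} → ℕ
quotGcd n r = _/_ n (gcd r n) {{≢-nonZero (gcd[m,n]≢0 r n (inj₂ (≢-nonZero⁻¹ n)))}}

{-# OPTIONS --safe #-}

-- Write x ∼ y when x = ζ y for a root of unity ζ. Modulo ∼ the group K^× is torsion free
-- (x^g ∼ y^g implies x ∼ y), so Bézout's identity turns α^a ∼ γ^b into
-- α ∈ μ_K K^(b / gcd(a,b)). For (1), α ∈ μ_K K^n and α ∈ μ_K K^r then give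
-- α ∈ μ_K K^lcm(n,r), and maximality of r forces lcm(n,r) = r.
-- For (2), let x = α^(1/n) ξ have degree d, with ξ^S = 1, so that x^(nS) = α^S lies in K.
-- The remainder of X^(nS) − α^S modulo the minimal polynomial P of x has degree < d and
-- vanishes at x, so it is zero and every root of P in the algebraic closure is an
-- (nS)-th root of α^S. As P splits, P(0)^(2nS) = α^(2Sd); hence α^d ∼ P(0)^n, so
-- α ∈ μ_K K^(n / gcd(d,n)), and by (1) n / gcd(d,n) divides r, which is equivalent to
-- n ∣ rd and to n / gcd(r,n) ∣ d.

module Submission where

open import Defs
open import Level using (Level; _⊔_)
open import Data.Nat as ℕ using (ℕ; zero; suc; _≤_; NonZero; ≢-nonZero; ≢-nonZero⁻¹; >-nonZero)
open import Data.Nat.Properties as ℕ using (m*n≢0)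
open import Data.Nat.Divisibility
  using (_∣_; divides; _∣?_; ∣-trans; *-monoʳ-∣; n∣m*n; ∣⇒≤; m/n∣o⇒m∣o*n; m∣n*o⇒m/n∣o)
open import Data.Nat.DivMod using (m/n*n≡m)
open import Data.Nat.GCD
  using ( gcd; gcd-GCD; gcd-greatest; gcd[m,n]∣m; gcd[m,n]∣n; gcd[m,n]≢0; n/gcd[m,n]≢0
        ; c*gcd[m,n]≡gcd[cm,cn]; module Bézout)
open import Data.Nat.LCM using (lcm; m∣lcm[m,n]; n∣lcm[m,n])
open import Data.Fin using (Fin; zero; suc; toℕ; inject₁; fromℕ)
open import Function using (_∘_)
open import Data.Vec.Functional using (Vector; []; _∷_; head; tail; init; last; replicate; map; zipWith)
open import Data.Product using (Σ; _×_; _,_; proj₁; proj₂)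
open import Data.Sum using (inj₂)
open import Data.Empty using (⊥-elim)
open import Relation.Nullary using (¬_; yes; no)
open import Relation.Nullary.Decidable using (decidable-stable; ¬¬-excluded-middle)
open import Relation.Binary.Bundles using (Preorder)
import Relation.Binary.Reasoning.Preorder
import Relation.Binary.Reasoning.Setoid
open import Algebra.Morphism.Structures using (module RingMorphisms)
open import Function.Bundles using (_⇔_; mk⇔; Equivalence)
import Relation.Binary.PropositionalEquality as ≡

gcd≢0ʳ : ∀ m n .{{_ : NonZero n}} → NonZero (gcd m n)
gcd≢0ʳ m n = ≢-nonZero (gcd[m,n]≢0 m n (inj₂ (≢-nonZero⁻¹ n)))

quotGcd∣⇔∣* : ∀ n m o .{{_ : NonZero n}} → quotGcd n m ∣ o ⇔ n ∣ o ℕ.* m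
quotGcd∣⇔∣* n m o = mk⇔
  (λ n/g∣o → ∣-trans (m/n∣o⇒m∣o*n (gcd[m,n]∣n m n) n/g∣o) (*-monoʳ-∣ o (gcd[m,n]∣m m n)))
  (λ n∣om → m∣n*o⇒m/n∣o (gcd[m,n]∣n m n)
     (≡.subst (n ∣_) (≡.sym (c*gcd[m,n]≡gcd[cm,cn] o m n)) (gcd-greatest n∣om (n∣m*n o))))
  where instance _ = gcd≢0ʳ m n

quotGcd≢0 : ∀ n m .{{_ : NonZero n}} → NonZero (quotGcd n m)
quotGcd≢0 n m = ≢-nonZero (n/gcd[m,n]≢0 m n)
  where instance _ = gcd≢0ʳ m n

quotGcd-swap : ∀ n m o .{{_ : NonZero n}} → quotGcd n m ∣ o → quotGcd n o ∣ m
quotGcd-swap n m o =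
  Equivalence.from (quotGcd∣⇔∣* n o m) ∘ ≡.subst (n ∣_) (ℕ.*-comm o m) ∘
  Equivalence.to (quotGcd∣⇔∣* n m o)

lcm≢0 : ∀ m n .{{_ : NonZero m}} .{{_ : NonZero n}} → NonZero (lcm m n)
lcm≢0 m@(suc _) n = m*n≢0 m (quotGcd n m) {{_}} {{quotGcd≢0 n m}}

module FieldProperties {c ℓ : Level} (K : Field c ℓ) where

  open Field K hiding (zero)
  module ≈-Reasoning = Relation.Binary.Reasoning.Setoid setoid
  open import Algebra.Solver.Ring.NaturalCoefficients.Default commutativeSemiring
  import Algebra.Properties.CommutativeSemiring.Exp commutativeSemiring as Exp

  infixr 8 _^_
  _^_ : Carrier → ℕ → Carrier
  _^_ = pow K

  pow≈^ : ∀ x n → x ^ n ≈ x Exp.^ n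
  pow≈^ x zero    = refl
  pow≈^ x (suc n) = *-congˡ (pow≈^ x n)

  ^-congˡ : ∀ n {x y} → x ≈ y → x ^ n ≈ y ^ n
  ^-congˡ zero    x≈y = refl
  ^-congˡ (suc n) x≈y = *-cong x≈y (^-congˡ n x≈y)

  1^n≈1 : ∀ n → 1# ^ n ≈ 1#
  1^n≈1 zero    = refl
  1^n≈1 (suc n) = trans (*-identityˡ _) (1^n≈1 n)

  ^-homo-* : ∀ x m n → x ^ (m ℕ.+ n) ≈ x ^ m * x ^ n
  ^-homo-* x m n = begin
    x ^ (m ℕ.+ n)          ≈⟨ pow≈^ x (m ℕ.+ n) ⟩
    x Exp.^ (m ℕ.+ n)      ≈⟨ Exp.^-homo-* x m n ⟩
    x Exp.^ m * x Exp.^ n  ≈⟨ *-cong (pow≈^ x m) (pow≈^ x n) ⟨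
    x ^ m * x ^ n          ∎
    where open ≈-Reasoning

  ^-assocʳ : ∀ x m n → (x ^ m) ^ n ≈ x ^ (m ℕ.* n)
  ^-assocʳ x m n = begin
    (x ^ m) ^ n          ≈⟨ pow≈^ (x ^ m) n ⟩
    (x ^ m) Exp.^ n      ≈⟨ Exp.^-congˡ n (pow≈^ x m) ⟩
    (x Exp.^ m) Exp.^ n  ≈⟨ Exp.^-assocʳ x m n ⟩
    x Exp.^ (m ℕ.* n)    ≈⟨ pow≈^ x (m ℕ.* n) ⟨
    x ^ (m ℕ.* n)        ∎
    where open ≈-Reasoning

  ^-^-≡ : ∀ x a b a′ b′ → a ℕ.* b ≡.≡ a′ ℕ.* b′ → (x ^ a) ^ b ≈ (x ^ a′) ^ b′
  ^-^-≡ x a b a′ b′ eq = begin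
    (x ^ a) ^ b       ≈⟨ ^-assocʳ x a b ⟩
    x ^ (a ℕ.* b)     ≡⟨ ≡.cong (x ^_) eq ⟩
    x ^ (a′ ℕ.* b′)   ≈⟨ ^-assocʳ x a′ b′ ⟨
    (x ^ a′) ^ b′     ∎
    where open ≈-Reasoning

  ^-comm : ∀ x m n → (x ^ m) ^ n ≈ (x ^ n) ^ m
  ^-comm x m n = ^-^-≡ x m n n m (ℕ.*-comm m n)

  ^-distrib-* : ∀ x y n → (x * y) ^ n ≈ x ^ n * y ^ n
  ^-distrib-* x y n = begin
    (x * y) ^ n            ≈⟨ pow≈^ (x * y) n ⟩
    (x * y) Exp.^ n        ≈⟨ Exp.^-distrib-* x y n ⟩
    x Exp.^ n * y Exp.^ n  ≈⟨ *-cong (pow≈^ x n) (pow≈^ y n) ⟨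
    x ^ n * y ^ n          ∎
    where open ≈-Reasoning

  x≈0⇒x^n≈0 : ∀ n .{{_ : NonZero n}} {x} → x ≈ 0# → x ^ n ≈ 0#
  x≈0⇒x^n≈0 (suc n) x≈0 = trans (*-congʳ x≈0) (zeroˡ _)

  cancel-inverseˡ : ∀ {x x⁻¹} y → x * x⁻¹ ≈ 1# → x⁻¹ * (x * y) ≈ y
  cancel-inverseˡ {x} {x⁻¹} y xx⁻¹≈1 = begin
    x⁻¹ * (x * y)  ≈⟨ solve 3 (λ x x⁻¹ y → x⁻¹ :* (x :* y) := (x :* x⁻¹) :* y) refl x x⁻¹ y ⟩
    (x * x⁻¹) * y  ≈⟨ *-congʳ xx⁻¹≈1 ⟩
    1# * y         ≈⟨ *-identityˡ y ⟩
    y              ∎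
    where open ≈-Reasoning

  cancel-inverseʳ : ∀ {x x⁻¹} y → x * x⁻¹ ≈ 1# → (y * x⁻¹) * x ≈ y
  cancel-inverseʳ {x} {x⁻¹} y xx⁻¹≈1 = begin
    (y * x⁻¹) * x  ≈⟨ solve 3 (λ x x⁻¹ y → (y :* x⁻¹) :* x := (x :* x⁻¹) :* y) refl x x⁻¹ y ⟩
    (x * x⁻¹) * y  ≈⟨ *-congʳ xx⁻¹≈1 ⟩
    1# * y         ≈⟨ *-identityˡ y ⟩
    y              ∎
    where open ≈-Reasoning

  *-cancelˡ : ∀ {x y z} → x ≉ 0# → x * y ≈ x * z → y ≈ z
  *-cancelˡ {x} {y} {z} x≉0 xy≈xz = begin
    y              ≈⟨ cancel-inverseˡ y xx⁻¹≈1 ⟨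
    x⁻¹ * (x * y)  ≈⟨ *-congˡ xy≈xz ⟩
    x⁻¹ * (x * z)  ≈⟨ cancel-inverseˡ z xx⁻¹≈1 ⟩
    z              ∎
    where
    open ≈-Reasoning
    x⁻¹ = proj₁ (inverse x x≉0)
    xx⁻¹≈1 = proj₂ (inverse x x≉0)

  *-cancelʳ : ∀ {x y z} → z ≉ 0# → x * z ≈ y * z → x ≈ y
  *-cancelʳ {x} {y} {z} z≉0 xz≈yz = *-cancelˡ z≉0 (trans (*-comm z x) (trans xz≈yz (*-comm y z)))

  ^-≉0 : ∀ n {x} → x ≉ 0# → x ^ n ≉ 0#
  ^-≉0 zero    x≉0 = 1≉0
  ^-≉0 (suc n) {x} x≉0 xxⁿ≈0 = ^-≉0 n x≉0 (*-cancelˡ x≉0 (trans xxⁿ≈0 (sym (zeroʳ x))))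

  μ : Carrier → Set ℓ
  μ = IsRootOfUnity K

  x^m≈1⇒x^[m*k]≈1 : ∀ {x} m k → x ^ m ≈ 1# → x ^ (m ℕ.* k) ≈ 1#
  x^m≈1⇒x^[m*k]≈1 {x} m k xᵐ≈1 = trans (sym (^-assocʳ x m k)) (trans (^-congˡ k xᵐ≈1) (1^n≈1 k))

  μ-1# : μ 1#
  μ-1# = 0 , *-identityʳ 1#

  μ-* : ∀ {ζ η} → μ ζ → μ η → μ (ζ * η)
  μ-* {ζ} {η} (m , ζᵐ≈1) (k , ηᵏ≈1) = k ℕ.+ m ℕ.* suc k , (begin
    (ζ * η) ^ mk        ≈⟨ ^-distrib-* ζ η mk ⟩
    ζ ^ mk * η ^ mk     ≈⟨ *-cong (x^m≈1⇒x^[m*k]≈1 (suc m) (suc k) ζᵐ≈1) ηᵐᵏ≈1 ⟩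
    1# * 1#             ≈⟨ *-identityˡ 1# ⟩
    1#                  ∎)
    where
    open ≈-Reasoning
    mk = suc m ℕ.* suc k
    ηᵐᵏ≈1 : η ^ mk ≈ 1#
    ηᵐᵏ≈1 = trans (reflexive (≡.cong (η ^_) (ℕ.*-comm (suc m) (suc k))))
                  (x^m≈1⇒x^[m*k]≈1 (suc k) (suc m) ηᵏ≈1)

  μ-^ : ∀ n {ζ} → μ ζ → μ (ζ ^ n)
  μ-^ n {ζ} (m , ζᵐ≈1) = m , trans (^-comm ζ n (suc m)) (trans (^-congˡ n ζᵐ≈1) (1^n≈1 n))

  μ-root : ∀ g {ζ} → μ (ζ ^ suc g) → μ ζ
  μ-root g {ζ} (m , ζᵍᵐ≈1) = m ℕ.+ g ℕ.* suc m , trans (sym (^-assocʳ ζ (suc g) (suc m))) ζᵍᵐ≈1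

  μ-resp-≈ : ∀ {ζ η} → ζ ≈ η → μ ζ → μ η
  μ-resp-≈ {ζ} {η} ζ≈η (m , ζᵐ≈1) = m , trans (^-congˡ (suc m) (sym ζ≈η)) ζᵐ≈1

  μ⇒≉0 : ∀ {ζ} → μ ζ → ζ ≉ 0#
  μ⇒≉0 (m , ζᵐ≈1) ζ≈0 = 1≉0 (trans (sym ζᵐ≈1) (x≈0⇒x^n≈0 (suc m) ζ≈0))

  μ-inverse : ∀ {ζ ζ⁻¹} → ζ * ζ⁻¹ ≈ 1# → μ ζ → μ ζ⁻¹
  μ-inverse {ζ} {ζ⁻¹} ζζ⁻¹≈1 (m , ζᵐ≈1) = m , (begin
    ζ⁻¹ ^ suc m                ≈⟨ *-identityˡ _ ⟨
    1# * ζ⁻¹ ^ suc m           ≈⟨ *-congʳ ζᵐ≈1 ⟨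
    ζ ^ suc m * ζ⁻¹ ^ suc m    ≈⟨ ^-distrib-* ζ ζ⁻¹ (suc m) ⟨
    (ζ * ζ⁻¹) ^ suc m          ≈⟨ ^-congˡ (suc m) ζζ⁻¹≈1 ⟩
    1# ^ suc m                 ≈⟨ 1^n≈1 (suc m) ⟩
    1#                         ∎)
    where open ≈-Reasoning

  x+y≈0⇒x*x≈y*y : ∀ {x y} → x + y ≈ 0# → x * x ≈ y * y
  x+y≈0⇒x*x≈y*y {x} {y} x+y≈0 = begin
    x * x                  ≈⟨ +-identityʳ (x * x) ⟨
    x * x + 0#             ≈⟨ +-congˡ (trans (*-congˡ x+y≈0) (zeroʳ y)) ⟨
    x * x + y * (x + y)    ≈⟨ solve 2 (λ x y → x :* x :+ y :* (x :+ y) := (x :+ y) :* x :+ y :* y) refl x y ⟩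
    (x + y) * x + y * y    ≈⟨ +-congʳ (trans (*-congʳ x+y≈0) (zeroˡ x)) ⟩
    0# + y * y             ≈⟨ +-identityˡ (y * y) ⟩
    y * y                  ∎
    where open ≈-Reasoning

  x*x≈x^2 : ∀ x → x * x ≈ x ^ 2
  x*x≈x^2 x = *-congˡ (sym (*-identityʳ x))

module ModuloRootsOfUnity {c ℓ : Level} (K : Field c ℓ) where

  open Field K hiding (zero)
  open FieldProperties K
  open import Algebra.Solver.Ring.NaturalCoefficients.Default commutativeSemiring

  infix 4 _∼_
  _∼_ : Carrier → Carrier → Set (c ⊔ ℓ)
  x ∼ y = Σ Carrier λ ζ → μ ζ × x ≈ ζ * y

  ≈⇒∼ : ∀ {x y} → x ≈ y → x ∼ y
  ≈⇒∼ {x} {y} x≈y = 1# , μ-1# , trans x≈y (sym (*-identityˡ y))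

  ∼-trans : ∀ {x y z} → x ∼ y → y ∼ z → x ∼ z
  ∼-trans {x} {y} {z} (ζ , ζ∈μ , x≈ζy) (η , η∈μ , y≈ηz) =
    ζ * η , μ-* ζ∈μ η∈μ , trans x≈ζy (trans (*-congˡ y≈ηz) (sym (*-assoc ζ η z)))

  ∼-sym : ∀ {x y} → x ∼ y → y ∼ x
  ∼-sym {x} {y} (ζ , ζ∈μ , x≈ζy) = ζ⁻¹ , μ-inverse ζζ⁻¹≈1 ζ∈μ , (begin
    y              ≈⟨ cancel-inverseˡ y ζζ⁻¹≈1 ⟨
    ζ⁻¹ * (ζ * y)  ≈⟨ *-congˡ x≈ζy ⟨
    ζ⁻¹ * x        ∎)
    where
    open ≈-Reasoning
    ζ⁻¹ = proj₁ (inverse ζ (μ⇒≉0 ζ∈μ))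
    ζζ⁻¹≈1 = proj₂ (inverse ζ (μ⇒≉0 ζ∈μ))

  ∼-preorder : Preorder c ℓ (c ⊔ ℓ)
  ∼-preorder = record
    { _≈_        = _≈_
    ; _≲_        = _∼_
    ; isPreorder = record { isEquivalence = isEquivalence ; reflexive = ≈⇒∼ ; trans = ∼-trans }
    }

  module ∼-Reasoning = Relation.Binary.Reasoning.Preorder ∼-preorder

  ∼-*-congˡ : ∀ x {y z} → y ∼ z → x * y ∼ x * z
  ∼-*-congˡ x {y} {z} (ζ , ζ∈μ , y≈ζz) = ζ , ζ∈μ , (begin
    x * y        ≈⟨ *-congˡ y≈ζz ⟩
    x * (ζ * z)  ≈⟨ solve 3 (λ x ζ z → x :* (ζ :* z) := ζ :* (x :* z)) refl x ζ z ⟩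
    ζ * (x * z)  ∎)
    where open ≈-Reasoning

  ∼-^ : ∀ n {x y} → x ∼ y → x ^ n ∼ y ^ n
  ∼-^ n {x} {y} (ζ , ζ∈μ , x≈ζy) = ζ ^ n , μ-^ n ζ∈μ , trans (^-congˡ n x≈ζy) (^-distrib-* ζ y n)

  ∼-cancelʳ : ∀ {x y z} → z ≉ 0# → x * z ∼ y * z → x ∼ y
  ∼-cancelʳ {x} {y} {z} z≉0 (ζ , ζ∈μ , xz≈ζyz) =
    ζ , ζ∈μ , *-cancelʳ z≉0 (trans xz≈ζyz (sym (*-assoc ζ y z)))

  ∼-≉0 : ∀ {x y} → x ≉ 0# → x ∼ y → y ≉ 0#
  ∼-≉0 {x} {y} x≉0 (ζ , _ , x≈ζy) y≈0 = x≉0 (trans x≈ζy (trans (*-congˡ y≈0) (zeroʳ ζ)))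

  ∼-^-cancel : ∀ g .{{_ : NonZero g}} {x y} → x ≉ 0# → x ^ g ∼ y ^ g → x ∼ y
  ∼-^-cancel g@(suc g′) {x} {y} x≉0 xᵍ∼yᵍ@(ζ , ζ∈μ , xᵍ≈ζyᵍ) =
    η , μ-root g′ ηᵍ∈μ , sym (cancel-inverseʳ x yy⁻¹≈1)
    where
    open ≈-Reasoning
    y≉0 : y ≉ 0#
    y≉0 y≈0 = ∼-≉0 (^-≉0 g x≉0) xᵍ∼yᵍ (x≈0⇒x^n≈0 g y≈0)
    y⁻¹ = proj₁ (inverse y y≉0)
    yy⁻¹≈1 = proj₂ (inverse y y≉0)
    η = x * y⁻¹
    ηᵍ≈ζ : η ^ g ≈ ζ
    ηᵍ≈ζ = begin
      (x * y⁻¹) ^ g            ≈⟨ ^-distrib-* x y⁻¹ g ⟩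
      x ^ g * y⁻¹ ^ g          ≈⟨ *-congʳ xᵍ≈ζyᵍ ⟩
      (ζ * y ^ g) * y⁻¹ ^ g    ≈⟨ *-assoc ζ _ _ ⟩
      ζ * (y ^ g * y⁻¹ ^ g)    ≈⟨ *-congˡ (^-distrib-* y y⁻¹ g) ⟨
      ζ * (y * y⁻¹) ^ g        ≈⟨ *-congˡ (trans (^-congˡ g yy⁻¹≈1) (1^n≈1 g)) ⟩
      ζ * 1#                   ≈⟨ *-identityʳ ζ ⟩
      ζ                        ∎
    ηᵍ∈μ : μ (η ^ g)
    ηᵍ∈μ = μ-resp-≈ (sym ηᵍ≈ζ) ζ∈μ

  ∼-^-≉0 : ∀ n .{{_ : NonZero n}} {x y} → x ≉ 0# → x ∼ y ^ n → y ≉ 0#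
  ∼-^-≉0 n x≉0 x∼yⁿ y≈0 = ∼-≉0 x≉0 x∼yⁿ (x≈0⇒x^n≈0 n y≈0)

  InMuPow⇒∼^ : ∀ {α} n → InMuPow K α n → Σ Carrier λ β → α ∼ β ^ n
  InMuPow⇒∼^ n (ζ , ζ∈μ , β , α≈ζβⁿ) = β , ζ , ζ∈μ , α≈ζβⁿ

  ∼^⇒InMuPow : ∀ {α} β n → α ∼ β ^ n → InMuPow K α n
  ∼^⇒InMuPow β n (ζ , ζ∈μ , α≈ζβⁿ) = ζ , ζ∈μ , β , α≈ζβⁿ

  ∼-quotient : ∀ {z u v} b → u ≉ 0# → z * u ^ b ∼ v ^ b → Σ Carrier λ δ → z ∼ δ ^ b
  ∼-quotient {z} {u} {v} b u≉0 zuᵇ∼vᵇ = v * u⁻¹ , ∼-cancelʳ (^-≉0 b u≉0) (begin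
    z * u ^ b              ∼⟨ zuᵇ∼vᵇ ⟩
    v ^ b                  ≈⟨ ^-congˡ b (cancel-inverseʳ v uu⁻¹≈1) ⟨
    ((v * u⁻¹) * u) ^ b    ≈⟨ ^-distrib-* (v * u⁻¹) u b ⟩
    (v * u⁻¹) ^ b * u ^ b  ∎)
    where
    open ∼-Reasoning
    u⁻¹ = proj₁ (inverse u u≉0)
    uu⁻¹≈1 = proj₂ (inverse u u≉0)

  ∼-bézout : ∀ {α γ a b g} → α ≉ 0# → γ ≉ 0# → α ^ a ∼ γ ^ b → Bézout.Identity g a b →
             Σ Carrier λ δ → α ^ g ∼ δ ^ b
  ∼-bézout {α} {γ} {a} {b} {g} α≉0 γ≉0 αᵃ∼γᵇ (Bézout.+- x y g+yb≡xa) =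
    ∼-quotient b (^-≉0 y α≉0) (begin
    α ^ g * (α ^ y) ^ b    ≈⟨ *-congˡ (^-assocʳ α y b) ⟩
    α ^ g * α ^ (y ℕ.* b)  ≈⟨ ^-homo-* α g (y ℕ.* b) ⟨
    α ^ (g ℕ.+ y ℕ.* b)    ≡⟨ ≡.cong (α ^_) g+yb≡xa ⟩
    α ^ (x ℕ.* a)          ≡⟨ ≡.cong (α ^_) (ℕ.*-comm x a) ⟩
    α ^ (a ℕ.* x)          ≈⟨ ^-assocʳ α a x ⟨
    (α ^ a) ^ x            ∼⟨ ∼-^ x αᵃ∼γᵇ ⟩
    (γ ^ b) ^ x            ≈⟨ ^-comm γ b x ⟩
    (γ ^ x) ^ b            ∎)
    where open ∼-Reasoning
  ∼-bézout {α} {γ} {a} {b} {g} α≉0 γ≉0 αᵃ∼γᵇ (Bézout.-+ x y g+xa≡yb) =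
    ∼-quotient b (^-≉0 x γ≉0) (begin
    α ^ g * (γ ^ x) ^ b    ≈⟨ *-congˡ (^-comm γ x b) ⟩
    α ^ g * (γ ^ b) ^ x    ∼⟨ ∼-*-congˡ (α ^ g) (∼-sym (∼-^ x αᵃ∼γᵇ)) ⟩
    α ^ g * (α ^ a) ^ x    ≈⟨ *-congˡ (^-assocʳ α a x) ⟩
    α ^ g * α ^ (a ℕ.* x)  ≈⟨ ^-homo-* α g (a ℕ.* x) ⟨
    α ^ (g ℕ.+ a ℕ.* x)    ≡⟨ ≡.cong (λ e → α ^ (g ℕ.+ e)) (ℕ.*-comm a x) ⟩
    α ^ (g ℕ.+ x ℕ.* a)    ≡⟨ ≡.cong (α ^_) g+xa≡yb ⟩
    α ^ (y ℕ.* b)          ≈⟨ ^-assocʳ α y b ⟨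
    (α ^ y) ^ b            ∎)
    where open ∼-Reasoning

  ^∼^⇒InMuPow : ∀ {α γ} a b .{{_ : NonZero b}} → α ≉ 0# → α ^ a ∼ γ ^ b → InMuPow K α (quotGcd b a)
  ^∼^⇒InMuPow {α} {γ} a b α≉0 αᵃ∼γᵇ
    with δ , αᵍ∼δᵇ ← ∼-bézout α≉0 (∼-^-≉0 b {y = γ} (^-≉0 a α≉0) αᵃ∼γᵇ) αᵃ∼γᵇ
                                (Bézout.identity (gcd-GCD a b))
    = ∼^⇒InMuPow δ (quotGcd b a) (∼-^-cancel g α≉0 (begin
      α ^ g                      ∼⟨ αᵍ∼δᵇ ⟩
      δ ^ b                      ≡⟨ ≡.cong (δ ^_) (m/n*n≡m (gcd[m,n]∣n a b)) ⟨
      δ ^ (quotGcd b a ℕ.* g)    ≈⟨ ^-assocʳ δ (quotGcd b a) g ⟨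
      (δ ^ quotGcd b a) ^ g      ∎))
    where
    open ∼-Reasoning
    instance _ = gcd≢0ʳ a b
    g = gcd a b

  InMuPow-∣ : ∀ {α m n} → m ∣ n → InMuPow K α n → InMuPow K α m
  InMuPow-∣ {m = m} (divides q ≡.refl) (ζ , ζ∈μ , β , α≈ζβⁿ) =
    ζ , ζ∈μ , β ^ q , trans α≈ζβⁿ (*-congˡ (sym (^-assocʳ β q m)))

  InMuPow-∼^ : ∀ {α} β m k → α ∼ β ^ m → InMuPow K β k → InMuPow K α (m ℕ.* k)
  InMuPow-∼^ {α} β m k α∼βᵐ β∈μKᵏ with δ , β∼δᵏ ← InMuPow⇒∼^ k β∈μKᵏ =
    ∼^⇒InMuPow δ (m ℕ.* k) (begin
    α              ∼⟨ α∼βᵐ ⟩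
    β ^ m          ∼⟨ ∼-^ m β∼δᵏ ⟩
    (δ ^ k) ^ m    ≈⟨ ^-assocʳ δ k m ⟩
    δ ^ (k ℕ.* m)  ≡⟨ ≡.cong (δ ^_) (ℕ.*-comm k m) ⟩
    δ ^ (m ℕ.* k)  ∎)
    where open ∼-Reasoning

  InMuPow-lcm : ∀ {α} m n .{{_ : NonZero m}} .{{_ : NonZero n}} →
                α ≉ 0# → InMuPow K α m → InMuPow K α n → InMuPow K α (lcm m n)
  InMuPow-lcm m@(suc _) n α≉0 α∈μKᵐ α∈μKⁿ
    with β , α∼βᵐ ← InMuPow⇒∼^ m α∈μKᵐ | γ , α∼γⁿ ← InMuPow⇒∼^ n α∈μKⁿ =
    InMuPow-∼^ β m (quotGcd n m) α∼βᵐ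
      (^∼^⇒InMuPow m n (∼-^-≉0 m {y = β} α≉0 α∼βᵐ) (∼-trans (∼-sym α∼βᵐ) α∼γⁿ))

  InMuPow⇔∣ : ∀ {α r} → α ≉ 0# → IsKummerExponent K α r →
              ∀ n .{{_ : NonZero n}} → InMuPow K α n ⇔ n ∣ r
  InMuPow⇔∣ {α} {r} α≉0 (1≤r , α∈μKʳ , maximal) n =
    mk⇔ InMuPow⇒∣ (λ n∣r → InMuPow-∣ n∣r α∈μKʳ)
    where
    instance _ = >-nonZero 1≤r
    InMuPow⇒∣ : InMuPow K α n → n ∣ r
    InMuPow⇒∣ α∈μKⁿ = ≡.subst (n ∣_) lcm≡r (m∣lcm[m,n] n r)
      where
      instance _ = lcm≢0 n r
      lcm≤r : lcm n r ≤ r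
      lcm≤r = maximal (lcm n r) (ℕ.>-nonZero⁻¹ (lcm n r)) (InMuPow-lcm n r α≉0 α∈μKⁿ α∈μKʳ)
      lcm≡r : lcm n r ≡.≡ r
      lcm≡r = ℕ.≤-antisym lcm≤r (∣⇒≤ (n∣lcm[m,n] n r))

  ∼-of-squared-powers : ∀ {α γ} n S d .{{_ : NonZero S}} → α ≉ 0# →
                        (γ * γ) ^ (n ℕ.* S) ≈ (α ^ S * α ^ S) ^ d → α ^ d ∼ γ ^ n
  ∼-of-squared-powers {α} {γ} n S d α≉0 eq =
    ∼-^-cancel (S ℕ.* 2) {{m*n≢0 S 2}} (^-≉0 d α≉0) (≈⇒∼ (begin
    (α ^ d) ^ (S ℕ.* 2)    ≈⟨ ^-comm α d (S ℕ.* 2) ⟩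
    (α ^ (S ℕ.* 2)) ^ d    ≈⟨ ^-congˡ d (^-assocʳ α S 2) ⟨
    ((α ^ S) ^ 2) ^ d      ≈⟨ ^-congˡ d (x*x≈x^2 (α ^ S)) ⟨
    (α ^ S * α ^ S) ^ d    ≈⟨ eq ⟨
    (γ * γ) ^ (n ℕ.* S)    ≈⟨ ^-congˡ (n ℕ.* S) (x*x≈x^2 γ) ⟩
    (γ ^ 2) ^ (n ℕ.* S)    ≈⟨ ^-^-≡ γ 2 (n ℕ.* S) n (S ℕ.* 2)
                                 (≡.trans (ℕ.*-comm 2 (n ℕ.* S)) (ℕ.*-assoc n S 2)) ⟩
    (γ ^ n) ^ (S ℕ.* 2)    ∎))
    where open ≈-Reasoning

module Polynomials {c ℓ : Level} (F : Field c ℓ) where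

  open Field F hiding (zero)
  open FieldProperties F
  open import Algebra.Solver.Ring.NaturalCoefficients.Default commutativeSemiring
  open import Algebra.Properties.Semiring.Sum semiring using (sum; sum-cong-≋; *-distribˡ-sum)
  open import Algebra.Properties.CommutativeSemigroup *-commutativeSemigroup using (x∙yz≈y∙xz)
  open ≈-Reasoning

  horner : ∀ m → Vector Carrier m → Carrier → Carrier
  horner zero    t x = 0#
  horner (suc m) t x = head t + x * horner m (tail t) x

  monic : ∀ m → Vector Carrier m → Carrier → Carrier
  monic zero    t x = 1#
  monic (suc m) t x = head t + x * monic m (tail t) x

  constant : ∀ m → Carrier → Vector Carrier (suc m)
  constant m a = a ∷ replicate m 0#

  horner-cong : ∀ m {t u} x → (∀ i → t i ≈ u i) → horner m t x ≈ horner m u x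
  horner-cong zero    x t≈u = refl
  horner-cong (suc m) x t≈u = +-cong (t≈u zero) (*-congˡ (horner-cong m x (t≈u ∘ suc)))

  horner-zero : ∀ m {t} x → (∀ i → t i ≈ 0#) → horner m t x ≈ 0#
  horner-zero zero    x t≈0 = refl
  horner-zero (suc m) {t} x t≈0 = begin
    t zero + x * horner m (tail t) x  ≈⟨ +-cong (t≈0 zero) (*-congˡ (horner-zero m x (t≈0 ∘ suc))) ⟩
    0# + x * 0#                       ≈⟨ +-identityˡ (x * 0#) ⟩
    x * 0#                            ≈⟨ zeroʳ x ⟩
    0#                                ∎

  horner-constant : ∀ m a x → horner (suc m) (constant m a) x ≈ a
  horner-constant m a x =
    trans (+-congˡ (trans (*-congˡ (horner-zero m x (λ _ → refl))) (zeroʳ x))) (+-identityʳ a)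

  *-distribˡ-horner : ∀ m k t x → k * horner m t x ≈ horner m (map (k *_) t) x
  *-distribˡ-horner zero    k t x = zeroʳ k
  *-distribˡ-horner (suc m) k t x = begin
    k * (t zero + x * horner m (tail t) x)
      ≈⟨ solve 4 (λ k a x h → k :* (a :+ x :* h) := k :* a :+ x :* (k :* h)) refl k (t zero) x _ ⟩
    k * t zero + x * (k * horner m (tail t) x)
      ≈⟨ +-congˡ (*-congˡ (*-distribˡ-horner m k (tail t) x)) ⟩
    k * t zero + x * horner m (map (k *_) (tail t)) x ∎

  horner-distrib-+ : ∀ m t u x → horner m (zipWith _+_ t u) x ≈ horner m t x + horner m u x
  horner-distrib-+ zero    t u x = sym (+-identityˡ 0#)
  horner-distrib-+ (suc m) t u x = begin
    (t zero + u zero) + x * horner m (zipWith _+_ (tail t) (tail u)) x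
      ≈⟨ +-congˡ (*-congˡ (horner-distrib-+ m (tail t) (tail u) x)) ⟩
    (t zero + u zero) + x * (horner m (tail t) x + horner m (tail u) x)
      ≈⟨ solve 5 (λ a b x h k → (a :+ b) :+ x :* (h :+ k) := (a :+ x :* h) :+ (b :+ x :* k))
                 refl (t zero) (u zero) x _ _ ⟩
    (t zero + x * horner m (tail t) x) + (u zero + x * horner m (tail u) x) ∎

  horner-init-last : ∀ m t x → horner (suc m) t x ≈ horner m (init t) x + last t * x ^ m
  horner-init-last zero    t x = solve 2 (λ a x → a :+ x :* con 0 := con 0 :+ a :* con 1) refl (t zero) x
  horner-init-last (suc m) t x = begin
    t zero + x * horner (suc m) (tail t) x
      ≈⟨ +-congˡ (*-congˡ (horner-init-last m (tail t) x)) ⟩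
    t zero + x * (horner m (init (tail t)) x + last t * x ^ m)
      ≈⟨ solve 5 (λ a x h b p → a :+ x :* (h :+ b :* p) := (a :+ x :* h) :+ b :* (x :* p))
                 refl (t zero) x _ (last t) (x ^ m) ⟩
    (t zero + x * horner m (init (tail t)) x) + last t * x ^ suc m ∎

  monic≈^+horner : ∀ m t x → monic m t x ≈ x ^ m + horner m t x
  monic≈^+horner zero    t x = sym (+-identityʳ 1#)
  monic≈^+horner (suc m) t x = begin
    t zero + x * monic m (tail t) x
      ≈⟨ +-congˡ (*-congˡ (monic≈^+horner m (tail t) x)) ⟩
    t zero + x * (x ^ m + horner m (tail t) x)
      ≈⟨ solve 4 (λ a x p h → a :+ x :* (p :+ h) := x :* p :+ (a :+ x :* h)) refl (t zero) x (x ^ m) _ ⟩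
    x ^ suc m + (t zero + x * horner m (tail t) x) ∎

  sumFin≈sum : ∀ m f → sumFin F m f ≈ sum f
  sumFin≈sum zero    f = refl
  sumFin≈sum (suc m) f = +-congˡ (sumFin≈sum m (f ∘ suc))

  horner≈sum : ∀ m t x → horner m t x ≈ sum (λ i → t i * x ^ toℕ i)
  horner≈sum zero    t x = refl
  horner≈sum (suc m) t x = +-cong (sym (*-identityʳ (t zero))) (begin
    x * horner m (tail t) x                    ≈⟨ *-congˡ (horner≈sum m (tail t) x) ⟩
    x * sum (λ i → t (suc i) * x ^ toℕ i)      ≈⟨ *-distribˡ-sum {m} x (λ i → t (suc i) * x ^ toℕ i) ⟩
    sum (λ i → x * (t (suc i) * x ^ toℕ i))    ≈⟨ sum-cong-≋ (λ i → x∙yz≈y∙xz x (t (suc i)) _) ⟩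
    sum (λ i → t (suc i) * (x * x ^ toℕ i))    ∎)

  evalMonic≈monic : ∀ m t x → evalMonic F m t x ≈ monic m t x
  evalMonic≈monic m t x = begin
    x ^ m + sumFin F m (λ i → t i * x ^ toℕ i)  ≈⟨ +-congˡ (sumFin≈sum m _) ⟩
    x ^ m + sum (λ i → t i * x ^ toℕ i)         ≈⟨ +-congˡ (horner≈sum m t x) ⟨
    x ^ m + horner m t x                        ≈⟨ monic≈^+horner m t x ⟨
    monic m t x                                 ∎

  monic-congʳ : ∀ m t {x y} → x ≈ y → monic m t x ≈ monic m t y
  monic-congʳ zero    t x≈y = refl
  monic-congʳ (suc m) t x≈y = +-congˡ (*-cong x≈y (monic-congʳ m (tail t) x≈y))

  divideByRoot : ∀ m → Vector Carrier (suc m) → Carrier → Vector Carrier m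
  divideByRoot zero    p y = []
  divideByRoot (suc m) p y = monic (suc m) (tail p) y ∷ divideByRoot m (tail p) y

  -- P(X) = (X − y) Q(X) + P(y), with the terms moved so that no subtraction occurs.
  monic-divideByRoot : ∀ m p y x →
    monic (suc m) p x + y * monic m (divideByRoot m p y) x ≈ x * monic m (divideByRoot m p y) x + monic (suc m) p y
  monic-divideByRoot zero p y x =
    solve 3 (λ a x y → (a :+ x :* con 1) :+ y :* con 1 := x :* con 1 :+ (a :+ y :* con 1)) refl (p zero) x y
  monic-divideByRoot (suc m) p y x = begin
    (p zero + x * P₁) + y * (q₀ + x * Q₁)
      ≈⟨ solve 6 (λ a x P y q Q → (a :+ x :* P) :+ y :* (q :+ x :* Q) := a :+ x :* (P :+ y :* Q) :+ y :* q)
                 refl (p zero) x P₁ y q₀ Q₁ ⟩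
    p zero + x * (P₁ + y * Q₁) + y * q₀
      ≈⟨ +-congʳ (+-congˡ (*-congˡ (monic-divideByRoot m (tail p) y x))) ⟩
    p zero + x * (x * Q₁ + q₀) + y * q₀
      ≈⟨ solve 5 (λ a x Q q y → a :+ x :* (x :* Q :+ q) :+ y :* q := x :* (q :+ x :* Q) :+ (a :+ y :* q))
                 refl (p zero) x Q₁ q₀ y ⟩
    x * (q₀ + x * Q₁) + (p zero + y * q₀) ∎
    where
    P₁ = monic (suc m) (tail p) x
    q₀ = monic (suc m) (tail p) y
    Q₁ = monic m (divideByRoot m (tail p) y) x

  -- The remainder of X^j modulo X^(d+1) + Σ p_i X^i: multiply the previous remainder by X
  -- and rewrite the overflowing X^(d+1) term.
  remainder : ∀ {d} → Vector Carrier (suc d) → ℕ → Vector Carrier (suc d)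
  remainder {d} p zero    = constant d 1#
  remainder {d} p (suc j) = zipWith _+_ (0# ∷ init r) (map (- last r *_) p)
    where r = remainder p j

  -- P(0) is ± the product of the roots of P; squaring removes the sign.
  monic[0]²-pow : IsAlgClosed F → ∀ N A m p → (∀ y → monic m p y ≈ 0# → y ^ N ≈ A) →
                  (monic m p 0# * monic m p 0#) ^ N ≈ (A * A) ^ m
  monic[0]²-pow ac N A zero    p roots = trans (^-congˡ N (*-identityˡ 1#)) (1^n≈1 N)
  monic[0]²-pow ac N A (suc m) p roots = begin
    (P₀ * P₀) ^ N                ≈⟨ ^-congˡ N (x+y≈0⇒x*x≈y*y P₀+yQ₀≈0) ⟩
    ((y * Q₀) * (y * Q₀)) ^ N    ≈⟨ ^-congˡ N (solve 2 (λ y q → (y :* q) :* (y :* q) := (y :* y) :* (q :* q))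
                                                       refl y Q₀) ⟩
    ((y * y) * (Q₀ * Q₀)) ^ N    ≈⟨ ^-distrib-* (y * y) (Q₀ * Q₀) N ⟩
    (y * y) ^ N * (Q₀ * Q₀) ^ N  ≈⟨ *-cong (trans (^-distrib-* y y N) (*-cong (roots y Py≈0) (roots y Py≈0)))
                                           (monic[0]²-pow ac N A m q roots-of-q) ⟩
    (A * A) * (A * A) ^ m        ∎
    where
    y = proj₁ (ac m p)
    Py≈0 : monic (suc m) p y ≈ 0#
    Py≈0 = trans (sym (evalMonic≈monic (suc m) p y)) (proj₂ (ac m p))
    q = divideByRoot m p y
    P₀ = monic (suc m) p 0#
    Q₀ = monic m q 0#
    P₀+yQ₀≈0 : P₀ + y * Q₀ ≈ 0#
    P₀+yQ₀≈0 = trans (monic-divideByRoot m p y 0#) (trans (+-cong (zeroˡ Q₀) Py≈0) (+-identityˡ 0#))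
    roots-of-q : ∀ z → monic m q z ≈ 0# → z ^ N ≈ A
    roots-of-q z Qz≈0 = roots z (begin
      monic (suc m) p z                      ≈⟨ +-identityʳ _ ⟨
      monic (suc m) p z + 0#                 ≈⟨ +-congˡ (trans (*-congˡ Qz≈0) (zeroʳ y)) ⟨
      monic (suc m) p z + y * monic m q z    ≈⟨ monic-divideByRoot m p y z ⟩
      z * monic m q z + monic (suc m) p y    ≈⟨ +-cong (trans (*-congˡ Qz≈0) (zeroʳ z)) Py≈0 ⟩
      0# + 0#                                ≈⟨ +-identityˡ 0# ⟩
      0#                                     ∎)

∀-init-last : ∀ {p} m {P : Fin (suc m) → Set p} → (∀ i → P (inject₁ i)) → P (fromℕ m) → ∀ i → P i
∀-init-last zero    P-init P-last zero    = P-last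
∀-init-last (suc m) P-init P-last zero    = P-init zero
∀-init-last (suc m) P-init P-last (suc i) = ∀-init-last m (P-init ∘ suc) P-last i

module FieldHomProperties {c ℓ c′ ℓ′ : Level} {K : Field c ℓ} {L : Field c′ ℓ′} (ι : FieldHom K L) where

  private
    module K where
      open Field K public
      open FieldProperties K public
      open ModuloRootsOfUnity K public
      open Polynomials K public
      open import Algebra.Properties.Group +-group public using (x∙y⁻¹≈ε⇒x≈y)

  open Field L hiding (zero)
  open FieldProperties L
  open Polynomials L
  open import Algebra.Solver.Ring.NaturalCoefficients.Default commutativeSemiring using (solve; _:+_; _:*_; _:=_)
  open import Algebra.Properties.Ring ring using (-‿distribˡ-*; -‿distribʳ-*)
  open import Algebra.Properties.Group +-group using (x∙y⁻¹≈ε⇒x≈y; x≈y⇒x∙y⁻¹≈ε; inverseˡ-unique)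
  open FieldHom ι
  open RingMorphisms (Field.rawRing K) (Field.rawRing L)
  open IsRingHomomorphism isRingHomomorphism
  open ≈-Reasoning

  ⟦⟧-^ : ∀ x n → ⟦ x K.^ n ⟧ ≈ ⟦ x ⟧ ^ n
  ⟦⟧-^ x zero    = 1#-homo
  ⟦⟧-^ x (suc n) = trans (*-homo x _) (*-congˡ (⟦⟧-^ x n))

  ⟦⟧-monic : ∀ m t x → ⟦ K.monic m t x ⟧ ≈ monic m (map ⟦_⟧ t) ⟦ x ⟧
  ⟦⟧-monic zero    t x = 1#-homo
  ⟦⟧-monic (suc m) t x = trans (+-homo _ _) (+-congˡ (trans (*-homo _ _) (*-congˡ (⟦⟧-monic m (tail t) x))))

  ⟦⟧-inverse : ∀ {u w} → u K.* w K.≈ K.1# → ⟦ u ⟧ * ⟦ w ⟧ ≈ 1#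
  ⟦⟧-inverse uw≈1 = trans (sym (*-homo _ _)) (trans (⟦⟧-cong uw≈1) 1#-homo)

  ⟦⟧-injective : ∀ {u v} → ⟦ u ⟧ ≈ ⟦ v ⟧ → ¬ ¬ (u K.≈ v)
  ⟦⟧-injective {u} {v} ⟦u⟧≈⟦v⟧ u≉v = 1≉0 (begin
    1#                       ≈⟨ ⟦⟧-inverse u-v*w≈1 ⟨
    ⟦ u K.- v ⟧ * ⟦ w ⟧      ≈⟨ *-congʳ (trans (+-homo u (K.- v)) (+-cong ⟦u⟧≈⟦v⟧ (-‿homo v))) ⟩
    (⟦ v ⟧ - ⟦ v ⟧) * ⟦ w ⟧  ≈⟨ *-congʳ (-‿inverseʳ ⟦ v ⟧) ⟩
    0# * ⟦ w ⟧               ≈⟨ zeroˡ ⟦ w ⟧ ⟩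
    0#                       ∎)
    where
    u-v≉0 : u K.- v K.≉ K.0#
    u-v≉0 = u≉v ∘ K.x∙y⁻¹≈ε⇒x≈y u v
    w = proj₁ (K.inverse (u K.- v) u-v≉0)
    u-v*w≈1 = proj₂ (K.inverse (u K.- v) u-v≉0)

  eval : ∀ {m} → Vector K.Carrier m → Carrier → Carrier
  eval {m} t y = horner m (map ⟦_⟧ t) y

  eval-+ : ∀ {m} t u y → eval {m} (zipWith K._+_ t u) y ≈ eval t y + eval u y
  eval-+ {m} t u y = trans (horner-cong m y (λ i → +-homo (t i) (u i))) (horner-distrib-+ m _ _ y)

  eval-* : ∀ {m} k t y → eval {m} (map (k K.*_) t) y ≈ ⟦ k ⟧ * eval t y
  eval-* {m} k t y = trans (horner-cong m y (λ i → *-homo k (t i))) (sym (*-distribˡ-horner m ⟦ k ⟧ _ y))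

  eval-constant : ∀ m a y → eval (K.constant m a) y ≈ ⟦ a ⟧
  eval-constant m a y = trans (horner-cong (suc m) y ⟦constant⟧) (horner-constant m ⟦ a ⟧ y)
    where
    ⟦constant⟧ : ∀ i → ⟦ K.constant m a i ⟧ ≈ constant m ⟦ a ⟧ i
    ⟦constant⟧ zero    = refl
    ⟦constant⟧ (suc i) = 0#-homo

  eval-zero : ∀ {m} {t} y → (∀ i → t i K.≈ K.0#) → eval {m} t y ≈ 0#
  eval-zero {m} y t≈0 = horner-zero m y (λ i → trans (⟦⟧-cong (t≈0 i)) 0#-homo)

  ^≈eval-remainder : ∀ {d} p {y} → monic (suc d) (map ⟦_⟧ p) y ≈ 0# →
                     ∀ j → y ^ j ≈ eval (K.remainder p j) y
  ^≈eval-remainder {d} p {y} Py≈0 zero    = sym (trans (eval-constant d K.1# y) 1#-homo)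
  ^≈eval-remainder {d} p {y} Py≈0 (suc j) = begin
    y * y ^ j                                          ≈⟨ *-congˡ (^≈eval-remainder p Py≈0 j) ⟩
    y * eval r y                                       ≈⟨ *-congˡ (horner-init-last d (map ⟦_⟧ r) y) ⟩
    y * (eval (init r) y + ⟦ l ⟧ * y ^ d)
      ≈⟨ solve 4 (λ y h l p → y :* (h :+ l :* p) := y :* h :+ l :* (y :* p)) refl y _ ⟦ l ⟧ (y ^ d) ⟩
    y * eval (init r) y + ⟦ l ⟧ * y ^ suc d
      ≈⟨ +-cong (sym (trans (+-congʳ 0#-homo) (+-identityˡ _))) ⟦l⟧yᵈ⁺¹≈⟦-l⟧P ⟩
    eval (K.0# ∷ init r) y + ⟦ K.- l ⟧ * eval p y      ≈⟨ +-congˡ (eval-* (K.- l) p y) ⟨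
    eval (K.0# ∷ init r) y + eval (map (K.- l K.*_) p) y ≈⟨ eval-+ (K.0# ∷ init r) (map (K.- l K.*_) p) y ⟨
    eval (K.remainder p (suc j)) y                     ∎
    where
    r = K.remainder p j
    l = last r
    yᵈ⁺¹+P≈0 : y ^ suc d + eval p y ≈ 0#
    yᵈ⁺¹+P≈0 = trans (sym (monic≈^+horner (suc d) (map ⟦_⟧ p) y)) Py≈0
    ⟦l⟧yᵈ⁺¹≈⟦-l⟧P : ⟦ l ⟧ * y ^ suc d ≈ ⟦ K.- l ⟧ * eval p y
    ⟦l⟧yᵈ⁺¹≈⟦-l⟧P = begin
      ⟦ l ⟧ * y ^ suc d        ≈⟨ *-congˡ (inverseˡ-unique _ _ yᵈ⁺¹+P≈0) ⟩
      ⟦ l ⟧ * - eval p y       ≈⟨ -‿distribʳ-* ⟦ l ⟧ _ ⟨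
      - (⟦ l ⟧ * eval p y)     ≈⟨ -‿distribˡ-* ⟦ l ⟧ _ ⟩
      - ⟦ l ⟧ * eval p y       ≈⟨ *-congʳ (-‿homo l) ⟨
      ⟦ K.- l ⟧ * eval p y     ∎

  leading≉0⇒RootOfMonicOver : ∀ {x} m (t : Vector K.Carrier (suc m)) →
                              eval t x ≈ 0# → last t K.≉ K.0# → RootOfMonicOver ι x m
  leading≉0⇒RootOfMonicOver {x} m t tx≈0 l≉0 = map (w K.*_) (init t) , (begin
    evalMonic L m (map ⟦_⟧ (map (w K.*_) (init t))) x  ≈⟨ evalMonic≈monic m _ x ⟩
    monic m (map ⟦_⟧ (map (w K.*_) (init t))) x        ≈⟨ monic≈^+horner m _ x ⟩
    x ^ m + eval (map (w K.*_) (init t)) x             ≈⟨ +-congˡ (eval-* w (init t) x) ⟩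
    x ^ m + ⟦ w ⟧ * eval (init t) x                    ≈⟨ +-comm _ _ ⟩
    ⟦ w ⟧ * eval (init t) x + x ^ m
      ≈⟨ +-congˡ (trans (*-congʳ ⟦l⟧⟦w⟧≈1) (*-identityˡ (x ^ m))) ⟨
    ⟦ w ⟧ * eval (init t) x + (⟦ l ⟧ * ⟦ w ⟧) * x ^ m
      ≈⟨ solve 4 (λ w h l p → w :* h :+ (l :* w) :* p := w :* (h :+ l :* p)) refl ⟦ w ⟧ _ ⟦ l ⟧ (x ^ m) ⟩
    ⟦ w ⟧ * (eval (init t) x + ⟦ l ⟧ * x ^ m)          ≈⟨ *-congˡ (horner-init-last m (map ⟦_⟧ t) x) ⟨
    ⟦ w ⟧ * eval t x                                   ≈⟨ *-congˡ tx≈0 ⟩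
    ⟦ w ⟧ * 0#                                         ≈⟨ zeroʳ ⟦ w ⟧ ⟩
    0#                                                 ∎)
    where
    l = last t
    w = proj₁ (K.inverse l l≉0)
    ⟦l⟧⟦w⟧≈1 = ⟦⟧-inverse (proj₂ (K.inverse l l≉0))

  -- Equality in K is not decidable, so the case split on the leading coefficient only
  -- yields a double-negated conclusion; the decidable final statement absorbs it.
  vanishing⇒zero : ∀ {x} m → (∀ e → RootOfMonicOver ι x e → m ≤ e) →
                   (t : Vector K.Carrier m) → eval t x ≈ 0# → ¬ ¬ (∀ i → t i K.≈ K.0#)
  vanishing⇒zero zero    minimal t tx≈0 t≉0 = t≉0 (λ ())
  vanishing⇒zero {x} (suc m) minimal t tx≈0 t≉0 = ¬¬-excluded-middle λ
    { (yes l≈0) → vanishing⇒zero m (λ e root → ℕ.<⇒≤ (minimal e root)) (init t) (init-vanishes l≈0)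
                    (λ init≈0 → t≉0 (∀-init-last m init≈0 l≈0))
    ; (no l≉0)  → ℕ.<-irrefl ≡.refl (minimal m (leading≉0⇒RootOfMonicOver m t tx≈0 l≉0))
    }
    where
    init-vanishes : last t K.≈ K.0# → eval (init t) x ≈ 0#
    init-vanishes l≈0 = begin
      eval (init t) x                            ≈⟨ +-identityʳ _ ⟨
      eval (init t) x + 0#                       ≈⟨ +-congˡ (trans (*-congʳ ⟦l⟧≈0) (zeroˡ (x ^ m))) ⟨
      eval (init t) x + ⟦ last t ⟧ * x ^ m       ≈⟨ horner-init-last m (map ⟦_⟧ t) x ⟨
      eval t x                                   ≈⟨ tx≈0 ⟩
      0#                                         ∎
      where ⟦l⟧≈0 = trans (⟦⟧-cong l≈0) 0#-homo

  roots-of-minimal : ∀ {x d N c} (p : Vector K.Carrier d) → (∀ e → RootOfMonicOver ι x e → d ≤ e) →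
                     monic d (map ⟦_⟧ p) x ≈ 0# → x ^ N ≈ ⟦ c ⟧ →
                     ¬ ¬ (∀ y → monic d (map ⟦_⟧ p) y ≈ 0# → y ^ N ≈ ⟦ c ⟧)
  roots-of-minimal {d = zero} p minimal Px≈0 xᴺ≈c ¬roots = ¬roots (λ y 1≈0 → ⊥-elim (1≉0 1≈0))
  roots-of-minimal {x} {suc d} {N} {c} p minimal Px≈0 xᴺ≈c ¬roots =
    vanishing⇒zero (suc d) minimal t tx≈0 λ t≈0 →
      ¬roots (λ y Py≈0 → trans (^≈eval-remainder p Py≈0 N)
                               (x∙y⁻¹≈ε⇒x≈y _ _ (trans (sym (eval-t y)) (eval-zero y t≈0))))
    where
    r = K.remainder p N
    t = zipWith K._+_ r (K.constant d (K.- c))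
    eval-t : ∀ y → eval t y ≈ eval r y - ⟦ c ⟧
    eval-t y = trans (eval-+ r (K.constant d (K.- c)) y) (+-congˡ (trans (eval-constant d (K.- c) y) (-‿homo c)))
    tx≈0 : eval t x ≈ 0#
    tx≈0 = trans (eval-t x) (x≈y⇒x∙y⁻¹≈ε (trans (sym (^≈eval-remainder p Px≈0 N)) xᴺ≈c))

  minimal-monic[0]²-pow : IsAlgClosed L → ∀ {x d N c} (p : Vector K.Carrier d) →
    (∀ e → RootOfMonicOver ι x e → d ≤ e) → evalMonic L d (map ⟦_⟧ p) x ≈ 0# → x ^ N ≈ ⟦ c ⟧ →
    ¬ ¬ ((K.monic d p K.0# K.* K.monic d p K.0#) K.^ N K.≈ (c K.* c) K.^ d)
  minimal-monic[0]²-pow ac {x} {d} {N} {c} p minimal Px≈0 xᴺ≈c ¬eq =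
    roots-of-minimal {N = N} p minimal (trans (sym (evalMonic≈monic d _ x)) Px≈0) xᴺ≈c λ roots →
      ⟦⟧-injective (begin
        ⟦ (P₀ K.* P₀) K.^ N ⟧                  ≈⟨ ⟦⟧-^ (P₀ K.* P₀) N ⟩
        ⟦ P₀ K.* P₀ ⟧ ^ N                      ≈⟨ ^-congˡ N (trans (*-homo P₀ P₀) (*-cong ⟦P₀⟧ ⟦P₀⟧)) ⟩
        (monic d p′ 0# * monic d p′ 0#) ^ N    ≈⟨ monic[0]²-pow ac N ⟦ c ⟧ d p′ roots ⟩
        (⟦ c ⟧ * ⟦ c ⟧) ^ d                    ≈⟨ ^-congˡ d (*-homo c c) ⟨
        ⟦ c K.* c ⟧ ^ d                        ≈⟨ ⟦⟧-^ (c K.* c) d ⟨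
        ⟦ (c K.* c) K.^ d ⟧                    ∎) ¬eq
    where
    P₀ = K.monic d p K.0#
    p′ = map ⟦_⟧ p
    ⟦P₀⟧ : ⟦ P₀ ⟧ ≈ monic d p′ 0#
    ⟦P₀⟧ = trans (⟦⟧-monic d p K.0#) (monic-congʳ d p′ 0#-homo)

  [aξ]^[n*S]≈⟦α^S⟧ : ∀ {a ξ α} n S → a ^ n ≈ ⟦ α ⟧ → ξ ^ S ≈ 1# →
                     (a * ξ) ^ (n ℕ.* S) ≈ ⟦ α K.^ S ⟧
  [aξ]^[n*S]≈⟦α^S⟧ {a} {ξ} {α} n S aⁿ≈⟦α⟧ ξˢ≈1 = begin
    (a * ξ) ^ (n ℕ.* S)            ≈⟨ ^-distrib-* a ξ (n ℕ.* S) ⟩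
    a ^ (n ℕ.* S) * ξ ^ (n ℕ.* S)  ≈⟨ *-cong (^-assocʳ a n S) (sym ξⁿˢ≈1) ⟨
    (a ^ n) ^ S * 1#               ≈⟨ *-identityʳ _ ⟩
    (a ^ n) ^ S                    ≈⟨ ^-congˡ S aⁿ≈⟦α⟧ ⟩
    ⟦ α ⟧ ^ S                      ≈⟨ ⟦⟧-^ α S ⟨
    ⟦ α K.^ S ⟧                    ∎
    where
    ξⁿˢ≈1 : ξ ^ (n ℕ.* S) ≈ 1#
    ξⁿˢ≈1 = trans (reflexive (≡.cong (ξ ^_) (ℕ.*-comm n S))) (x^m≈1⇒x^[m*k]≈1 S n ξˢ≈1)

  quotGcd∣degree : IsAlgClosed L → ∀ {α r} → α K.≉ K.0# → IsKummerExponent K α r →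
                   ∀ n .{{_ : NonZero n}} a → a ^ n ≈ ⟦ α ⟧ → ∀ ξ → IsRootOfUnity L ξ →
                   ∀ d → DegreeOver ι (a * ξ) d → quotGcd n r ∣ d
  quotGcd∣degree ac {α} {r} α≉0 ρ n a aⁿ≈⟦α⟧ ξ (s , ξˢ≈1) d ((p , Px≈0) , minimal) =
    decidable-stable (quotGcd n r ∣? d) λ ∤ →
      minimal-monic[0]²-pow ac {N = n ℕ.* S} p minimal Px≈0 xᴺ≈⟦αˢ⟧ λ P₀²ᴺ≈α²ˢᵈ →
        ∤ (quotGcd-swap n d r (Equivalence.to (K.InMuPow⇔∣ α≉0 ρ (quotGcd n d))
             (K.^∼^⇒InMuPow d n α≉0 (K.∼-of-squared-powers n S d α≉0 P₀²ᴺ≈α²ˢᵈ))))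
    where
    S = suc s
    xᴺ≈⟦αˢ⟧ = [aξ]^[n*S]≈⟦α^S⟧ n S aⁿ≈⟦α⟧ ξˢ≈1
    instance _ = quotGcd≢0 n d

proposition4p2 : ∀ {c ℓ c' ℓ' : Level} (K : Field c ℓ) → CharZero K →
    (α : Field.Carrier K) → ¬ (Field._≈_ K α (Field.0# K)) →
    (r : ℕ) → IsKummerExponent K α r →
    (n : ℕ) → .{{_ : NonZero n}} →
    (InMuPow K α n ⇔ (n ∣ r)) ×
    (∀ (L : Field c' ℓ') (ι : FieldHom K L) → IsAlgebraicClosure ι →
      (a : Field.Carrier L) → Field._≈_ L (pow L a n) (FieldHom.⟦_⟧ ι α) →
      (ξ : Field.Carrier L) → IsRootOfUnity L ξ →
      (d : ℕ) → DegreeOver ι (Field._*_ L a ξ) d →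
      quotGcd n r ∣ d)
proposition4p2 K _ α α≉0 r ρ n =
  ModuloRootsOfUnity.InMuPow⇔∣ K α≉0 ρ n ,
  λ L ι (algebraicallyClosed , _) → FieldHomProperties.quotGcd∣degree ι algebraicallyClosed α≉0 ρ n
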